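{- Fix an integer $m\ge3$. Then $\lim_{n\to\infty}|\tau_{C_m\odot\overline{K}_n}|=\infty$.
   Context: An edge-magic labeling of a graph $G$ with $p$ vertices and $q$ edges is a bijection $f:V(G)\cup E(G)\to\{1,\dots,p+q\}$ such that $f(x)+f(xy)+f(y)$ is a constant (the valence) for all edges $xy$. Let $T_G=\{(\sum_{u\in V}\deg(u)g(u)+\sum_{e\in E}g(e))/q : g:V\cup E\to\{1,\dots,p+q\}\text{ bijective}\}$, $J_G=\{\lceil\min T_G\rceil,\dots,\lfloor\max T_G\rfloor\}$, and $\tau_G=\{k\in J_G: k\text{ is the valence of some edge-magic labeling of }G\}$. $C_m$ is the cycle of length $m$, and $C_m\odot\overline{K}_n$ is obtained from $C_m$ by attaching $n$ pendant vertices to each vertex. -}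

module Defs where

open import Data.Nat using (ℕ; zero; suc; _+_; _*_; _≤_; _%_)
open import Data.Nat.DivMod using (m%n<n)
open import Data.Fin using (Fin; toℕ; fromℕ<; splitAt; remQuot; _↑ˡ_; _↑ʳ_) renaming (_≟_ to _≟ᶠ_)
open import Data.List using (List; tabulate)
open import Data.Nat.ListAction using (sum)
open import Data.Product using (_×_; _,_; proj₁; proj₂; Σ; ∃; ∃-syntax)
open import Data.Sum using (_⊎_; inj₁; inj₂)
open import Relation.Nullary.Decidable using (⌊_⌋)
open import Data.Bool using (if_then_else_)
open import Relation.Binary.PropositionalEquality using (_≡_)
open import Function.Bundles using (_⤖_; Bijection)

record Graph : Set where
  field
    p : ℕ
    q : ℕ
    ends : Fin q → Fin p × Fin p
open Graph public

Σ[<_]_ : (n : ℕ) → (Fin n → ℕ) → ℕ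
Σ[< n ] f = sum (tabulate {n = n} f)

Elt : Graph → Set
Elt G = Fin (p G) ⊎ Fin (q G)

-- Bijections V ∪ E → {1,…,p+q}; the label of x is 1 + toℕ (to x).
Labeling : Graph → Set
Labeling G = Elt G ⤖ Fin (p G + q G)

lab : (G : Graph) → Labeling G → Elt G → ℕ
lab G g x = suc (toℕ (Bijection.to g x))

deg : (G : Graph) → Fin (p G) → ℕ
deg G u = Σ[< q G ] λ e →
  (if ⌊ proj₁ (ends G e) ≟ᶠ u ⌋ then 1 else 0) + (if ⌊ proj₂ (ends G e) ≟ᶠ u ⌋ then 1 else 0)

-- numerator of the elements of T_G:  Σ_u deg(u) g(u) + Σ_e g(e)
weight : (G : Graph) → Labeling G → ℕ
weight G g = Σ[< p G ] (λ u → deg G u * lab G g (inj₁ u)) + Σ[< q G ] (λ e → lab G g (inj₂ e))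

IsEdgeMagic : (G : Graph) → Labeling G → ℕ → Set
IsEdgeMagic G f k = (e : Fin (q G)) →
  lab G f (inj₁ (proj₁ (ends G e))) + lab G f (inj₂ e) + lab G f (inj₁ (proj₂ (ends G e))) ≡ k

-- min T_G = s / q  and  max T_G = s / q  (s the extremal weight)
IsMinWeight : Graph → ℕ → Set
IsMinWeight G s = (∃[ g ] weight G g ≡ s) × ((g : Labeling G) → s ≤ weight G g)

IsMaxWeight : Graph → ℕ → Set
IsMaxWeight G s = (∃[ g ] weight G g ≡ s) × ((g : Labeling G) → weight G g ≤ s)

-- k ∈ J_G  ⇔  ⌈min T_G⌉ ≤ k ≤ ⌊max T_G⌋  ⇔  min T_G ≤ k ≤ max T_G (k integer)
--          ⇔  smin ≤ k·q ≤ smax.  (All elements of T_G are positive, so k ∈ ℕ.)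
InJ : Graph → ℕ → Set
InJ G k = ∃[ smin ] ∃[ smax ] IsMinWeight G smin × IsMaxWeight G smax
          × (smin ≤ k * q G) × (k * q G ≤ smax)

InTau : Graph → ℕ → Set
InTau G k = InJ G k × ∃[ f ] IsEdgeMagic G f k

CardTauAtLeast : Graph → ℕ → Set
CardTauAtLeast G B = Σ (Fin B → ℕ) λ h →
  ((i j : Fin B) → h i ≡ h j → i ≡ j) × ((i : Fin B) → InTau G (h i))

next : ∀ {m} → Fin m → Fin m
next {suc k} i = fromℕ< (m%n<n (suc (toℕ i)) (suc k))

-- Vertices: cycle vertex i ↦ i ↑ˡ (m*n) (i < m); pendant (i,j)
-- ↦ m ↑ʳ t where remQuot t = (i , j).  Edges: e ↑ˡ _ is the cycle edge
-- {e, e+1 mod m}; m ↑ʳ t is the pendant edge {i, pendant t}.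
corona : (m n : ℕ) → Graph
corona m n = record { p = m + m * n ; q = m + m * n ; ends = ed }
  where
  ed : Fin (m + m * n) → Fin (m + m * n) × Fin (m + m * n)
  ed e with splitAt m e
  ... | inj₁ i = (i ↑ˡ (m * n)) , (next i ↑ˡ (m * n))
  ... | inj₂ t = (proj₁ (remQuot {m} n t) ↑ˡ (m * n)) , (m ↑ʳ t)

module Submission where

-- 1. For every graph G, the valence k of an edge-magic labelling lies in τ_G:
--    counting each edge at its two ends shows that the labelling has weight
--    k·q, and the extremal weights of the finitely many labellings exist.
-- 2. A cycle seed is an edge-magic labelling of C_m by 1,…,2m.  Explicit seeds
--    are given for odd m, for m ≡ 2 and for m ≡ 0 (mod 4); each is described by
--    its vertex labels and checked with decoders that recover a position from
--    its vertex label and from its edge sum.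
-- 3. A seed blows up to C_m ⊙ K̄_n using n+1 blocks of 2m consecutive labels:
--    the cycle vertices lie in block s, the cycle edges in block n − s, and the
--    j-th pendants of all cycle vertices and their edges in the remaining blocks
--    in the same pattern.  Every edge then has sum 3 + 2m·(s + n) + K, so the
--    blocks s = 0,…,B−1 give B distinct valences when n ≥ B.

open import Defs
open import Data.Nat
  using (ℕ; zero; suc; _+_; _*_; _∸_; _%_; _≤_; _<_; _≤?_; _<?_; z≤n; s≤s; s≤s⁻¹; s<s⁻¹; NonZero)
open import Data.Nat.DivMod using (m%n<n; m<n⇒m%n≡m; n%n≡0)
open import Data.Nat.Properties
open import Data.Nat.ListAction using (sum)
open import Data.Fin as Fin using (Fin; toℕ; splitAt; join) renaming (_≟_ to _≟ᶠ_)
open import Data.Fin.Properties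
  using ( any?; all?; punchOut-injective; injective⇒≤; toℕ-injective; toℕ-fromℕ<; toℕ<n
        ; splitAt-join; join-splitAt; splitAt-↑ˡ; splitAt-↑ʳ; remQuot-combine; combine-remQuot; toℕ-combine
        ; punchIn-injective; punchInᵢ≢i; opposite-prop; opposite-involutive; toℕ-cast
        ; toℕ≤pred[n]; toℕ-inject≤)
open import Data.Fin.Base using (punchOut; punchIn)
open import Data.List as List using (List; []; _∷_; cartesianProductWith)
open import Data.List.Membership.Propositional using (_∈_)
open import Data.List.Membership.Propositional.Properties using (∈-allFin; ∈-map⁺; ∈-cartesianProductWith⁺)
import Data.List.Relation.Unary.All as All
open import Data.List.Relation.Unary.Any using (here)
open import Data.List.Extrema.Nat using (argmin; argmax; f[argmin]≤f[xs]; f[xs]≤f[argmax])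
open import Data.List.Properties using (tabulate-cong)
open import Data.Vec as Vec using (Vec; lookup)
open import Data.Vec.Properties using (lookup∘tabulate)
open import Data.Product using (_×_; _,_; proj₁; proj₂; ∃; ∃-syntax; uncurry)
open import Data.Sum using (_⊎_; inj₁; inj₂)
open import Data.Bool using (if_then_else_)
open import Data.Empty using (⊥-elim)
open import Relation.Nullary using (Dec; yes; no; ¬_; does)
open import Relation.Nullary.Decidable using (⌊_⌋; _→-dec_)
open import Relation.Binary.PropositionalEquality
open import Relation.Binary.Definitions using (tri<; tri≈; tri>)
open import Function using (_∘_)
open import Function.Definitions using (Injective)
open import Function.Bundles using (Bijection; mk⤖)
open import Data.Nat.Tactic.RingSolver using (solve-∀)

Σ-cong : ∀ n {f g : Fin n → ℕ} → (∀ i → f i ≡ g i) → Σ[< n ] f ≡ Σ[< n ] g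
Σ-cong n f≗g = cong sum (tabulate-cong f≗g)

Σ-+ : ∀ n (f g : Fin n → ℕ) → Σ[< n ] (λ i → f i + g i) ≡ Σ[< n ] f + Σ[< n ] g
Σ-+ zero    f g = refl
Σ-+ (suc n) f g = trans (cong (f Fin.zero + g Fin.zero +_) (Σ-+ n (f ∘ Fin.suc) (g ∘ Fin.suc)))
                        (swap-middle (f Fin.zero) (g Fin.zero) _ _)
  where
  swap-middle : ∀ a b c d → (a + b) + (c + d) ≡ (a + c) + (b + d)
  swap-middle = solve-∀

Σ-*ʳ : ∀ n (f : Fin n → ℕ) c → Σ[< n ] (λ i → f i * c) ≡ Σ[< n ] f * c
Σ-*ʳ zero    f c = refl
Σ-*ʳ (suc n) f c = trans (cong (f Fin.zero * c +_) (Σ-*ʳ n (f ∘ Fin.suc) c))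
                         (sym (*-distribʳ-+ c (f Fin.zero) _))

Σ-const : ∀ n k → Σ[< n ] (λ _ → k) ≡ k * n
Σ-const zero    k = sym (*-zeroʳ k)
Σ-const (suc n) k = trans (cong (k +_) (Σ-const n k)) (sym (*-suc k n))

Σ-swap : ∀ a b (H : Fin a → Fin b → ℕ) →
         Σ[< a ] (λ i → Σ[< b ] (H i)) ≡ Σ[< b ] (λ j → Σ[< a ] (λ i → H i j))
Σ-swap zero    b H = sym (Σ-const b 0)
Σ-swap (suc a) b H = trans (cong (Σ[< b ] (H Fin.zero) +_) (Σ-swap a b (H ∘ Fin.suc)))
                           (sym (Σ-+ b (H Fin.zero) _))

-- The indicator of  v = u , exactly as it occurs in the definition of deg.
δ : ∀ {n} → Fin n → Fin n → ℕ
δ v u = if ⌊ v ≟ᶠ u ⌋ then 1 else 0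

Σ-δ : ∀ n (v : Fin n) (l : Fin n → ℕ) → Σ[< n ] (λ u → δ v u * l u) ≡ l v
Σ-δ (suc n) Fin.zero    l = trans (cong (l Fin.zero + 0 +_) (Σ-const n 0)) (trans (+-identityʳ _) (+-identityʳ _))
Σ-δ (suc n) (Fin.suc v) l = trans (Σ-cong n (λ u → cong (_* l (Fin.suc u)) (δ-suc u))) (Σ-δ n v (l ∘ Fin.suc))
  where
  δ-suc : ∀ u → δ (Fin.suc v) (Fin.suc u) ≡ δ v u
  δ-suc u with v ≟ᶠ u
  ... | yes _ = refl
  ... | no _  = refl

-- Handshake: the weight of an edge-magic labelling

module _ (G : Graph) where

  end₁ end₂ : Fin (q G) → Fin (p G)
  end₁ e = proj₁ (ends G e)
  end₂ e = proj₂ (ends G e)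

  degree-sum : (l : Fin (p G) → ℕ) →
               Σ[< p G ] (λ u → deg G u * l u) ≡ Σ[< q G ] (λ e → l (end₁ e) + l (end₂ e))
  degree-sum l = begin
      Σ[< p G ] (λ u → deg G u * l u)
    ≡⟨ Σ-cong (p G) (λ u → sym (Σ-*ʳ (q G) (λ e → δ (end₁ e) u + δ (end₂ e) u) (l u))) ⟩
      Σ[< p G ] (λ u → Σ[< q G ] (λ e → (δ (end₁ e) u + δ (end₂ e) u) * l u))
    ≡⟨ Σ-swap (p G) (q G) _ ⟩
      Σ[< q G ] (λ e → Σ[< p G ] (λ u → (δ (end₁ e) u + δ (end₂ e) u) * l u))
    ≡⟨ Σ-cong (q G) edge ⟩
      Σ[< q G ] (λ e → l (end₁ e) + l (end₂ e)) ∎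
    where
    open ≡-Reasoning
    edge : ∀ e → Σ[< p G ] (λ u → (δ (end₁ e) u + δ (end₂ e) u) * l u) ≡ l (end₁ e) + l (end₂ e)
    edge e = trans (Σ-cong (p G) (λ u → *-distribʳ-+ (l u) (δ (end₁ e) u) (δ (end₂ e) u)))
                   (trans (Σ-+ (p G) _ _) (cong₂ _+_ (Σ-δ (p G) (end₁ e) l) (Σ-δ (p G) (end₂ e) l)))

  magic-weight : (f : Labeling G) (k : ℕ) → IsEdgeMagic G f k → weight G f ≡ k * q G
  magic-weight f k magic = begin
      weight G f
    ≡⟨ cong (_+ Σ[< q G ] (λ e → l (inj₂ e))) (degree-sum (l ∘ inj₁)) ⟩
      Σ[< q G ] (λ e → l (inj₁ (end₁ e)) + l (inj₁ (end₂ e))) + Σ[< q G ] (λ e → l (inj₂ e))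
    ≡⟨ sym (Σ-+ (q G) _ _) ⟩
      Σ[< q G ] (λ e → l (inj₁ (end₁ e)) + l (inj₁ (end₂ e)) + l (inj₂ e))
    ≡⟨ Σ-cong (q G) (λ e → trans (swap-last (l (inj₁ (end₁ e))) (l (inj₁ (end₂ e))) (l (inj₂ e))) (magic e)) ⟩
      Σ[< q G ] (λ _ → k)
    ≡⟨ Σ-const (q G) k ⟩
      k * q G ∎
    where
    open ≡-Reasoning
    l : Elt G → ℕ
    l = lab G f
    swap-last : ∀ a b c → a + b + c ≡ a + c + b
    swap-last = solve-∀

injective⇒surjective : ∀ {n} (f : Fin n → Fin n) → Injective _≡_ _≡_ f → ∀ y → ∃[ x ] f x ≡ y
injective⇒surjective {suc n} f f-inj y with any? (λ x → f x ≟ᶠ y)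
... | yes hit = hit
... | no miss = ⊥-elim (<-irrefl refl (injective⇒≤ {f = squeeze} squeeze-inj))
  where
  avoids : ∀ x → y ≢ f x
  avoids x y≡fx = miss (x , sym y≡fx)
  squeeze : Fin (suc n) → Fin n
  squeeze x = punchOut (avoids x)
  squeeze-inj : Injective _≡_ _≡_ squeeze
  squeeze-inj {x} {z} eq = f-inj (punchOut-injective (avoids x) (avoids z) eq)

labelling : (G : Graph) (φ : Elt G → Fin (p G + q G)) → Injective _≡_ _≡_ φ → Labeling G
labelling G φ φ-inj = mk⤖ (φ-inj , onto)
  where
  ψ : Fin (p G + q G) → Fin (p G + q G)
  ψ = φ ∘ splitAt (p G)
  ψ-inj : Injective _≡_ _≡_ ψ
  ψ-inj {x} {y} eq = trans (sym (join-splitAt (p G) (q G) x))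
                           (trans (cong (join (p G) (q G)) (φ-inj eq)) (join-splitAt (p G) (q G) y))
  onto : ∀ y → ∃ λ x → ∀ {z} → z ≡ x → φ z ≡ y
  onto y with injective⇒surjective ψ ψ-inj y
  ... | x , ψx≡y = splitAt (p G) x , λ { refl → ψx≡y }

vectors : ∀ {A : Set} → List A → (L : ℕ) → List (Vec A L)
vectors xs zero    = Vec.[] ∷ []
vectors xs (suc L) = cartesianProductWith Vec._∷_ xs (vectors xs L)

∈-vectors : ∀ {A : Set} {xs : List A} → (∀ x → x ∈ xs) → ∀ {L} (v : Vec A L) → v ∈ vectors xs L
∈-vectors all∈ Vec.[]      = here refl
∈-vectors all∈ (x Vec.∷ v) = ∈-cartesianProductWith⁺ Vec._∷_ (all∈ x) (∈-vectors all∈ v)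

weight-cong : (G : Graph) (g h : Labeling G) → (∀ x → Bijection.to g x ≡ Bijection.to h x) →
              weight G g ≡ weight G h
weight-cong G g h g≗h =
  cong₂ _+_ (Σ-cong (p G) (λ u → cong (λ y → deg G u * suc (toℕ y)) (g≗h (inj₁ u))))
            (Σ-cong (q G) (λ e → cong (suc ∘ toℕ) (g≗h (inj₂ e))))

-- Labellings of G are coded by vectors of labels; the finitely many codes
-- yield a list of labellings realising every weight.  The labelling g₀ is
-- used for the codes that are not injective.
module Enumeration (G : Graph) (g₀ : Labeling G) where

  N : ℕ
  N = p G + q G

  read : Vec (Fin N) N → Elt G → Fin N
  read c x = lookup c (join (p G) (q G) x)

  LookupInjective : Vec (Fin N) N → Set
  LookupInjective c = ∀ i j → lookup c i ≡ lookup c j → i ≡ j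

  read-injective : ∀ c → LookupInjective c → Injective _≡_ _≡_ (read c)
  read-injective c inj {x} {y} eq = trans (sym (splitAt-join (p G) (q G) x))
    (trans (cong (splitAt (p G)) (inj _ _ eq)) (splitAt-join (p G) (q G) y))

  lookup-injective? : ∀ c → Dec (LookupInjective c)
  lookup-injective? c = all? (λ i → all? (λ j → (lookup c i ≟ᶠ lookup c j) →-dec (i ≟ᶠ j)))

  decode : Vec (Fin N) N → Labeling G
  decode c with lookup-injective? c
  ... | yes inj = labelling G (read c) (read-injective c inj)
  ... | no _    = g₀

  encode : Labeling G → Vec (Fin N) N
  encode g = Vec.tabulate (Bijection.to g ∘ splitAt (p G))

  read-encode : ∀ g x → read (encode g) x ≡ Bijection.to g x
  read-encode g x = trans (lookup∘tabulate _ (join (p G) (q G) x))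
                          (cong (Bijection.to g) (splitAt-join (p G) (q G) x))

  encode-injective : ∀ g → LookupInjective (encode g)
  encode-injective g i j eq = trans (sym (join-splitAt (p G) (q G) i))
    (trans (cong (join (p G) (q G)) (Bijection.injective g
             (trans (sym (lookup∘tabulate _ i)) (trans eq (lookup∘tabulate _ j)))))
           (join-splitAt (p G) (q G) j))

  decode-encode : ∀ g x → Bijection.to (decode (encode g)) x ≡ Bijection.to g x
  decode-encode g x with lookup-injective? (encode g)
  ... | yes _   = read-encode g x
  ... | no ¬inj = ⊥-elim (¬inj (encode-injective g))

  candidates : List (Labeling G)
  candidates = List.map decode (vectors (List.allFin N) N)

  covers : ∀ g → ∃[ g′ ] (g′ ∈ candidates × weight G g′ ≡ weight G g)
  covers g = decode (encode g)
           , ∈-map⁺ decode (∈-vectors ∈-allFin (encode g))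
           , weight-cong G (decode (encode g)) g (decode-encode g)

  minimum-weight : ∃[ s ] IsMinWeight G s
  minimum-weight = weight G best , (best , refl) , below
    where
    best : Labeling G
    best = argmin (weight G) g₀ candidates
    below : ∀ g → weight G best ≤ weight G g
    below g with covers g
    ... | g′ , g′∈ , same =
      ≤-trans (All.lookup (f[argmin]≤f[xs] {f = weight G} g₀ candidates) g′∈) (≤-reflexive same)

  maximum-weight : ∃[ s ] IsMaxWeight G s
  maximum-weight = weight G best , (best , refl) , above
    where
    best : Labeling G
    best = argmax (weight G) g₀ candidates
    above : ∀ g → weight G g ≤ weight G best
    above g with covers g
    ... | g′ , g′∈ , same =
      ≤-trans (≤-reflexive (sym same)) (All.lookup (f[xs]≤f[argmax] {f = weight G} g₀ candidates) g′∈)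

-- The valence k of an edge-magic labelling lies between min T_G and max T_G,
-- because k·q is the weight of that labelling; so k ∈ τ_G.
magic⇒τ : (G : Graph) (f : Labeling G) (k : ℕ) → IsEdgeMagic G f k → InTau G k
magic⇒τ G f k magic =
  let open Enumeration G f
      (smin , isMin) = minimum-weight
      (smax , isMax) = maximum-weight
      w≡kq = magic-weight G f k magic
  in  (smin , smax , isMin , isMax , ≤-trans (proj₂ isMin f) (≤-reflexive w≡kq)
                                   , ≤-trans (≤-reflexive (sym w≡kq)) (proj₂ isMax f))
    , f , magic

-- Edge-magic labellings of the cycle C_m by the offsets 0,…,2m−1

sucmod-cases : ∀ {a m} .{{_ : NonZero m}} → a < m →
               (suc a < m × suc a % m ≡ suc a) ⊎ (suc a ≡ m × suc a % m ≡ 0)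
sucmod-cases {a} {m} a<m with suc a <? m
... | yes lt = inj₁ (lt , m<n⇒m%n≡m lt)
... | no ¬lt = inj₂ (sa≡m , trans (cong (_% m) sa≡m) (n%n≡0 m))
  where
  sa≡m : suc a ≡ m
  sa≡m = ≤-antisym a<m (≮⇒≥ ¬lt)

sucmod-injective : ∀ {a b m} .{{_ : NonZero m}} → a < m → b < m → suc a % m ≡ suc b % m → a ≡ b
sucmod-injective a<m b<m eq with sucmod-cases a<m | sucmod-cases b<m
... | inj₁ (_ , ea) | inj₁ (_ , eb) = suc-injective (trans (sym ea) (trans eq eb))
... | inj₂ (la , _) | inj₂ (lb , _) = suc-injective (trans la (sym lb))
... | inj₁ (_ , ea) | inj₂ (_ , eb) = ⊥-elim (1+n≢0 (trans (sym ea) (trans eq eb)))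
... | inj₂ (_ , ea) | inj₁ (_ , eb) = ⊥-elim (1+n≢0 (trans (sym eb) (trans (sym eq) ea)))

toℕ-next : ∀ {k} (i : Fin (suc k)) → toℕ (next i) ≡ suc (toℕ i) % suc k
toℕ-next {k} i = toℕ-fromℕ< (m%n<n (suc (toℕ i)) (suc k))

next-injective : ∀ {k} → Injective _≡_ _≡_ (next {suc k})
next-injective {k} {i} {j} eq = toℕ-injective (sucmod-injective (toℕ<n i) (toℕ<n j)
  (trans (sym (toℕ-next i)) (trans (cong toℕ eq) (toℕ-next j))))

-- An edge-magic labelling of C_m whose labels, shifted down by one, are
-- exactly 0,…,2m−1: vertex i gets X i, the edge {i, i+1} gets Y i.
record CycleSeed (m : ℕ) : Set where
  field
    X Y         : Fin m → Fin (m + m)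
    K           : ℕ
    X-injective : Injective _≡_ _≡_ X
    Y-injective : Injective _≡_ _≡_ Y
    X≢Y         : ∀ i j → X i ≢ Y j
    magic       : ∀ i → toℕ (X i) + toℕ (X (next i)) + toℕ (Y i) ≡ K

-- Blowing a cycle seed up to C_m ⊙ K̄_n

-- Offsets are combined with "blocks" 0,…,n into labels block·2m + offset.
combine-injective : ∀ {a b} {i i′ : Fin a} {j j′ : Fin b} →
                    Fin.combine i j ≡ Fin.combine i′ j′ → i ≡ i′ × j ≡ j′
combine-injective {b = b} {i} {i′} {j} {j′} eq =
  cong proj₁ pairs , cong proj₂ pairs
  where
  pairs : (i , j) ≡ (i′ , j′)
  pairs = trans (sym (remQuot-combine i j)) (trans (cong (Fin.remQuot b) eq) (remQuot-combine i′ j′))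

cast-injective : ∀ {a b} .(eq : a ≡ b) → Injective _≡_ _≡_ (Fin.cast eq)
cast-injective eq {i} {j} e = toℕ-injective (trans (sym (toℕ-cast eq i)) (trans (cong toℕ e) (toℕ-cast eq j)))

opposite-injective : ∀ {a} → Injective _≡_ _≡_ (Fin.opposite {a})
opposite-injective {_} {i} {j} e = trans (sym (opposite-involutive i)) (trans (cong Fin.opposite e) (opposite-involutive j))

-- The seed is used n+1 times, once per block; the cycle vertices sit in block s
-- and the cycle edges in block n − s, while the j-th pendants of all cycle
-- vertices sit in the remaining blocks, in the same pattern.  Every edge then
-- has label sum 3 + 2m·(s + n) + K.
module BlowUp {k : ℕ} (seed : CycleSeed (suc k)) (n : ℕ) (s : Fin (suc n)) where
  open CycleSeed seed

  m D : ℕ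
  m = suc k
  D = m + m

  G : Graph
  G = corona m n

  -- A pendant t hangs at cycle vertex  base t  and is its  index t -th pendant.
  base : Fin (m * n) → Fin m
  base t = proj₁ (Fin.remQuot {m} n t)

  index : Fin (m * n) → Fin n
  index t = proj₂ (Fin.remQuot {m} n t)

  base-index-injective : ∀ {t t′} → base t ≡ base t′ → index t ≡ index t′ → t ≡ t′
  base-index-injective {t} {t′} eb ei = trans (sym (combine-remQuot {m} n t))
    (trans (cong₂ Fin.combine eb ei) (combine-remQuot {m} n t′))

  Part : Set
  Part = Fin m ⊎ Fin (m * n)

  block : Part → Fin (suc n)
  block (inj₁ _) = s
  block (inj₂ t) = punchIn s (index t)

  offset : (Fin m → Fin D) → (Fin m → Fin D) → Part → Fin D
  offset O₁ O₂ (inj₁ i) = O₁ i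
  offset O₁ O₂ (inj₂ t) = O₂ (base t)

  -- An element is determined by its block and an offset that is injective on
  -- each part (pendants of one layer are told apart by their base vertex).
  block-offset-injective : ∀ {O₁ O₂} → Injective _≡_ _≡_ O₁ → Injective _≡_ _≡_ O₂ →
    ∀ r r′ → block r ≡ block r′ → offset O₁ O₂ r ≡ offset O₁ O₂ r′ → r ≡ r′
  block-offset-injective O₁-inj O₂-inj (inj₁ i) (inj₁ i′) _  eo = cong inj₁ (O₁-inj eo)
  block-offset-injective O₁-inj O₂-inj (inj₁ i) (inj₂ t′) eb _  = ⊥-elim (punchInᵢ≢i s (index t′) (sym eb))
  block-offset-injective O₁-inj O₂-inj (inj₂ t) (inj₁ i′) eb _  = ⊥-elim (punchInᵢ≢i s (index t) eb)
  block-offset-injective O₁-inj O₂-inj (inj₂ t) (inj₂ t′) eb eo =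
    cong inj₂ (base-index-injective (O₂-inj eo) (punchIn-injective s (index t) (index t′) eb))

  vertex-offset edge-offset : Part → Fin D
  vertex-offset = offset X (X ∘ next)
  edge-offset   = offset Y Y

  vertex≢edge : ∀ r r′ → vertex-offset r ≢ edge-offset r′
  vertex≢edge (inj₁ i) (inj₁ j) = X≢Y i j
  vertex≢edge (inj₁ i) (inj₂ t) = X≢Y i (base t)
  vertex≢edge (inj₂ t) (inj₁ j) = X≢Y (next (base t)) j
  vertex≢edge (inj₂ t) (inj₂ u) = X≢Y (next (base t)) (base u)

  size : suc n * D ≡ p G + q G
  size = count m n
    where
    count : ∀ m n → suc n * (m + m) ≡ (m + m * n) + (m + m * n)
    count = solve-∀

  code : Elt G → Fin (suc n) × Fin D
  code (inj₁ v) = block (splitAt m v) , vertex-offset (splitAt m v)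
  code (inj₂ e) = Fin.opposite (block (splitAt m e)) , edge-offset (splitAt m e)

  φ : Elt G → Fin (p G + q G)
  φ x = Fin.cast size (Fin.combine (proj₁ (code x)) (proj₂ (code x)))

  splitAt-injective : ∀ {a b} {x y : Fin (a + b)} → splitAt a x ≡ splitAt a y → x ≡ y
  splitAt-injective {a} {b} {x} {y} eq =
    trans (sym (join-splitAt a b x)) (trans (cong (join a b) eq) (join-splitAt a b y))

  code-injective : ∀ x y → code x ≡ code y → x ≡ y
  code-injective (inj₁ v) (inj₁ v′) eq = cong inj₁ (splitAt-injective
    (block-offset-injective {X} {X ∘ next} X-injective (λ e → next-injective (X-injective e)) _ _
                            (cong proj₁ eq) (cong proj₂ eq)))
  code-injective (inj₂ e) (inj₂ e′) eq = cong inj₂ (splitAt-injective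
    (block-offset-injective {Y} {Y} Y-injective Y-injective _ _ (opposite-injective (cong proj₁ eq)) (cong proj₂ eq)))
  code-injective (inj₁ v) (inj₂ e)  eq = ⊥-elim (vertex≢edge (splitAt m v) (splitAt m e) (cong proj₂ eq))
  code-injective (inj₂ e) (inj₁ v)  eq = ⊥-elim (vertex≢edge (splitAt m v) (splitAt m e) (sym (cong proj₂ eq)))

  φ-injective : Injective _≡_ _≡_ φ
  φ-injective {x} {y} eq = code-injective x y (uncurry (cong₂ _,_)
    (combine-injective {i = proj₁ (code x)} {proj₁ (code y)} {proj₂ (code x)} {proj₂ (code y)} (cast-injective size eq)))

  f : Labeling G
  f = labelling G φ φ-injective

  valence : ℕ
  valence = 3 + (D * (toℕ s + n) + K)

  vertex-label : ∀ v {r} → splitAt m v ≡ r →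
                 lab G f (inj₁ v) ≡ suc (D * toℕ (block r) + toℕ (vertex-offset r))
  vertex-label v refl = cong suc (trans (toℕ-cast size _) (toℕ-combine (block (splitAt m v)) (vertex-offset (splitAt m v))))

  edge-label : ∀ e {r} → splitAt m e ≡ r →
               lab G f (inj₂ e) ≡ suc (D * (n ∸ toℕ (block r)) + toℕ (edge-offset r))
  edge-label e refl = cong suc (trans (toℕ-cast size _)
    (trans (toℕ-combine (Fin.opposite (block (splitAt m e))) (edge-offset (splitAt m e)))
           (cong (λ b → D * b + toℕ (edge-offset (splitAt m e))) (opposite-prop (block (splitAt m e))))))

  edge-sum : ∀ a b x y z → b ≤ n → x + z + y ≡ K →
             suc (D * a + x) + suc (D * (n ∸ b) + y) + suc (D * b + z) ≡ 3 + (D * (a + n) + K)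
  edge-sum a b x y z b≤n xzy≡K = begin
      suc (D * a + x) + suc (D * (n ∸ b) + y) + suc (D * b + z)
    ≡⟨ regroup D a (n ∸ b) b x y z ⟩
      3 + (D * (a + (n ∸ b + b)) + (x + z + y))
    ≡⟨ cong₂ (λ c w → 3 + (D * (a + c) + w)) (m∸n+n≡m b≤n) xzy≡K ⟩
      3 + (D * (a + n) + K) ∎
    where
    open ≡-Reasoning
    regroup : ∀ D a c b x y z → suc (D * a + x) + suc (D * c + y) + suc (D * b + z)
                              ≡ 3 + (D * (a + (c + b)) + (x + z + y))
    regroup = solve-∀

  ends-cycle : ∀ e {i} → splitAt m e ≡ inj₁ i → ends G e ≡ (i Fin.↑ˡ (m * n) , next i Fin.↑ˡ (m * n))
  ends-cycle e eq with splitAt m e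
  ends-cycle e refl | _ = refl

  ends-pendant : ∀ e {t} → splitAt m e ≡ inj₂ t → ends G e ≡ (base t Fin.↑ˡ (m * n) , m Fin.↑ʳ t)
  ends-pendant e eq with splitAt m e
  ends-pendant e refl | _ = refl

  s≤n : toℕ s ≤ n
  s≤n = toℕ≤pred[n] s

  edge-magic : IsEdgeMagic G f valence
  edge-magic e = by-part (splitAt m e) refl
    where
    by-part : ∀ r → splitAt m e ≡ r →
      lab G f (inj₁ (proj₁ (ends G e))) + lab G f (inj₂ e) + lab G f (inj₁ (proj₂ (ends G e))) ≡ valence
    by-part (inj₁ i) eq rewrite ends-cycle e eq =
      trans (cong₂ _+_ (cong₂ _+_ (vertex-label (i Fin.↑ˡ (m * n)) (splitAt-↑ˡ m i (m * n))) (edge-label e eq))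
                       (vertex-label (next i Fin.↑ˡ (m * n)) (splitAt-↑ˡ m (next i) (m * n))))
            (edge-sum (toℕ s) (toℕ s) _ _ _ s≤n (CycleSeed.magic seed i))
    by-part (inj₂ t) eq rewrite ends-pendant e eq =
      trans (cong₂ _+_ (cong₂ _+_ (vertex-label (base t Fin.↑ˡ (m * n)) (splitAt-↑ˡ m (base t) (m * n))) (edge-label e eq))
                       (vertex-label (m Fin.↑ʳ t) (splitAt-↑ʳ m (m * n) t)))
            (edge-sum (toℕ s) (toℕ (block (inj₂ t))) _ _ _ (toℕ≤pred[n] (block (inj₂ t))) (CycleSeed.magic seed (base t)))

many-valences : ∀ {k} → CycleSeed (suc k) → ∀ B n → B ≤ n → CardTauAtLeast (corona (suc k) n) B
many-valences {k} seed B n B≤n =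
  valence ∘ layer , distinct , λ i → magic⇒τ _ (BlowUp.f seed n (layer i)) _ (BlowUp.edge-magic seed n (layer i))
  where
  layer : Fin B → Fin (suc n)
  layer i = Fin.inject≤ i (m≤n⇒m≤1+n B≤n)
  valence : Fin (suc n) → ℕ
  valence = BlowUp.valence seed n
  distinct : ∀ i j → valence (layer i) ≡ valence (layer j) → i ≡ j
  distinct i j eq = toℕ-injective (begin
      toℕ i                  ≡⟨ toℕ-inject≤ i _ ⟨
      toℕ (layer i)          ≡⟨ +-cancelʳ-≡ n _ _ (*-cancelˡ-≡ _ _ (suc k + suc k)
                                  (+-cancelʳ-≡ (CycleSeed.K seed) _ _ (suc-injective (suc-injective (suc-injective eq))))) ⟩
      toℕ (layer j)          ≡⟨ toℕ-inject≤ j _ ⟩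
      toℕ j                  ∎)
    where open ≡-Reasoning

-- Cycle seeds from vertex labels

if-yes : ∀ {P A : Set} (d : Dec P) {a b : A} → P → (if does d then a else b) ≡ a
if-yes (yes _) _ = refl
if-yes (no ¬p) p = ⊥-elim (¬p p)

if-no : ∀ {P A : Set} (d : Dec P) {a b : A} → ¬ P → (if does d then a else b) ≡ b
if-no (yes p) ¬p = ⊥-elim (¬p p)
if-no (no _)  _  = refl

-- Vertex labels X at the positions 0,…,m−1 of C_m (m = suc k) determine a seed:
-- the edge {i, i+1} gets K − S i, where S i is the sum of its end labels.
module VertexLabels (k : ℕ) (X : ℕ → ℕ) where

  m : ℕ
  m = suc k

  S : ℕ → ℕ
  S i = X i + X (suc i % m)

  S-step : ∀ {i x y} → suc i < m → X i ≡ x → X (suc i) ≡ y → S i ≡ x + y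
  S-step {i} lt ex ey = trans (cong (λ j → X i + X j) (m<n⇒m%n≡m lt)) (cong₂ _+_ ex ey)

  S-last : ∀ {x y} → X k ≡ x → X 0 ≡ y → S k ≡ x + y
  S-last ex ey = trans (cong (λ j → X k + X j) (n%n≡0 m)) (cong₂ _+_ ex ey)

  record Profile (unX unS : ℕ → ℕ) (V T : ℕ → Set) (i : ℕ) : Set where
    field
      x σ  : ℕ
      X≡   : X i ≡ x
      S≡   : S i ≡ σ
      unX≡ : unX x ≡ i
      unS≡ : unS σ ≡ i
      x∈V  : V x
      σ∈T  : T σ

  seed : (K : ℕ) (unX unS : ℕ → ℕ) (V T : ℕ → Set) →
         (∀ {x} → V x → x < m + m) →
         (∀ {σ} → T σ → σ ≤ K × K < σ + (m + m)) →
         (∀ {x σ} → V x → T σ → x + σ ≢ K) →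
         (∀ {i} → i < m → Profile unX unS V T i) → CycleSeed m
  seed K unX unS V T V<2m T-range V+T≢K profile = record
    { X = X′ ; Y = Y′ ; K = K
    ; X-injective = λ {i} {j} eq → toℕ-injective (X-inj (toℕ<n i) (toℕ<n j)
                      (trans (sym (X′-toℕ i)) (trans (cong toℕ eq) (X′-toℕ j))))
    ; Y-injective = λ {i} {j} eq → toℕ-injective (S-inj (toℕ<n i) (toℕ<n j)
                      (∸-cancelˡ-≡ (S≤K (toℕ<n i)) (S≤K (toℕ<n j))
                        (trans (sym (Y′-toℕ i)) (trans (cong toℕ eq) (Y′-toℕ j)))))
    ; X≢Y = λ i j eq → V+T≢K (x∈V (toℕ<n i)) (σ∈T (toℕ<n j))
              (trans (cong (_+ S (toℕ j)) (trans (sym (X′-toℕ i)) (trans (cong toℕ eq) (Y′-toℕ j))))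
                     (m∸n+n≡m (S≤K (toℕ<n j))))
    ; magic = λ i → trans (cong₂ _+_ (cong₂ _+_ (X′-toℕ i)
                                  (trans (X′-toℕ (next i)) (cong X (toℕ-next i)))) (Y′-toℕ i))
                          (m+[n∸m]≡n (S≤K (toℕ<n i)))
    }
    where
    open Profile using (X≡; S≡; unX≡; unS≡)
    x∈V : ∀ {i} (i<m : i < m) → V (X i)
    x∈V i<m = subst V (sym (X≡ (profile i<m))) (Profile.x∈V (profile i<m))
    σ∈T : ∀ {i} (i<m : i < m) → T (S i)
    σ∈T i<m = subst T (sym (S≡ (profile i<m))) (Profile.σ∈T (profile i<m))
    S≤K : ∀ {i} → i < m → S i ≤ K
    S≤K i<m = proj₁ (T-range (σ∈T i<m))
    X-inj : ∀ {i j} → i < m → j < m → X i ≡ X j → i ≡ j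
    X-inj i<m j<m eq = trans (sym (unX≡ (profile i<m)))
      (trans (cong unX (trans (sym (X≡ (profile i<m))) (trans eq (X≡ (profile j<m))))) (unX≡ (profile j<m)))
    S-inj : ∀ {i j} → i < m → j < m → S i ≡ S j → i ≡ j
    S-inj i<m j<m eq = trans (sym (unS≡ (profile i<m)))
      (trans (cong unS (trans (sym (S≡ (profile i<m))) (trans eq (S≡ (profile j<m))))) (unS≡ (profile j<m)))
    X′ Y′ : Fin m → Fin (m + m)
    X′ i = Fin.fromℕ< (V<2m (x∈V (toℕ<n i)))
    Y′ i = Fin.fromℕ< (+-cancelˡ-< (S (toℕ i)) _ _
             (≤-<-trans (≤-reflexive (m+[n∸m]≡n (S≤K (toℕ<n i)))) (proj₂ (T-range (σ∈T (toℕ<n i))))))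
    X′-toℕ : ∀ i → toℕ (X′ i) ≡ X (toℕ i)
    X′-toℕ i = toℕ-fromℕ< _
    Y′-toℕ : ∀ i → toℕ (Y′ i) ≡ K ∸ S (toℕ i)
    Y′-toℕ i = toℕ-fromℕ< _

interleave : (ℕ → ℕ) → (ℕ → ℕ) → ℕ → ℕ
interleave E O zero          = E 0
interleave E O (suc zero)    = O 0
interleave E O (suc (suc i)) = interleave (E ∘ suc) (O ∘ suc) i

interleave-even : ∀ E O r → interleave E O (r * 2) ≡ E r
interleave-even E O zero    = refl
interleave-even E O (suc r) = interleave-even (E ∘ suc) (O ∘ suc) r

interleave-odd : ∀ E O r → interleave E O (suc (r * 2)) ≡ O r
interleave-odd E O zero    = refl
interleave-odd E O (suc r) = interleave-odd (E ∘ suc) (O ∘ suc) r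

data Parity : ℕ → Set where
  even : ∀ r → Parity (r * 2)
  odd  : ∀ r → Parity (suc (r * 2))

parity : ∀ i → Parity i
parity zero = even 0
parity (suc i) with parity i
... | even r = odd r
... | odd r  = even (suc r)

+-double : ∀ h → h + h ≡ h * 2
+-double = solve-∀

sum-wu : ∀ h r → h + r + r ≡ h + r * 2
sum-wu = solve-∀

sum-uw : ∀ h r → r + (h + r) ≡ h + r * 2
sum-uw = solve-∀

sum-uw′ : ∀ h r → r + (h + suc r) ≡ h + suc (r * 2)
sum-uw′ = solve-∀

sum-wu′ : ∀ h r → h + r + suc r ≡ h + suc (r * 2)
sum-wu′ = solve-∀

sum-uw⁺ : ∀ h r → suc r + (h + r) ≡ h + suc (r * 2)
sum-uw⁺ = solve-∀

sum-wu⁺ : ∀ h r → h + r + suc (suc r) ≡ h + suc (suc (r * 2))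
sum-wu⁺ = solve-∀

even≢odd′ : ∀ x y → x * 2 ≢ suc (y * 2)
even≢odd′ x y e = even≢odd x y (trans (*-comm 2 x) (trans e (cong suc (*-comm y 2))))

-- Odd cycles, m = 2h + 1: position 2r gets r and position 2r+1 gets h+1+r.
-- The edge {i, i+1} then has sum h+1+i, except the closing edge {2h, 0}
-- with sum h; so the vertex labels are 0,…,2h and, with K = 5h + 1, the
-- edge labels K − (edge sum) are 2h+1,…,4h+1.

module OddCycle (h : ℕ) where

  E O X : ℕ → ℕ
  E r = r
  O r = suc (h + r)
  X   = interleave E O

  open VertexLabels (h * 2) X using (S; S-step; S-last; Profile; seed)

  K : ℕ
  K = suc (h * 5)

  unX unS : ℕ → ℕ
  unX v = if does (v ≤? h) then v * 2 else suc ((v ∸ suc h) * 2)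
  unS σ = if does (σ ≤? h) then h * 2 else σ ∸ suc h

  V T : ℕ → Set
  V x = x ≤ h * 2
  T σ = σ ≡ h ⊎ ∃[ i ] (i < h * 2 × σ ≡ suc h + i)

  regular : ∀ {i x} → X i ≡ x → S i ≡ suc h + i → unX x ≡ i → V x → i < h * 2 → Profile unX unS V T i
  regular {i} X≡ S≡ unX≡ x∈V i<2h = record
    { X≡ = X≡ ; S≡ = S≡ ; unX≡ = unX≡ ; x∈V = x∈V
    ; unS≡ = trans (if-no (_ ≤? h) (<⇒≱ (s≤s (m≤m+n h i)))) (m+n∸m≡n (suc h) i)
    ; σ∈T = inj₂ (i , i<2h , refl)
    }

  profile : ∀ {i} → i < suc (h * 2) → Profile unX unS V T i
  profile {i} i<m with parity i
  ... | odd r =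
    regular (interleave-odd E O r)
            (trans (S-step (s≤s (*-monoˡ-≤ 2 r<h)) (interleave-odd E O r) (interleave-even E O (suc r))) (sum-wu′ (suc h) r))
            (trans (if-no (_ ≤? h) (<⇒≱ (s≤s (m≤m+n h r)))) (cong (λ v → suc (v * 2)) (m+n∸m≡n h r)))
            (≤-trans (≤-reflexive (sym (+-suc h r))) (≤-trans (+-monoʳ-≤ h r<h) (≤-reflexive (+-double h))))
            (*-monoˡ-≤ 2 r<h)
    where
    r<h : r < h
    r<h = *-cancelʳ-< 2 r h (s<s⁻¹ i<m)
  ... | even r with m≤n⇒m<n∨m≡n (*-cancelʳ-≤ r h 2 (s≤s⁻¹ i<m))
  ...   | inj₁ r<h =
    regular (interleave-even E O r)
            (trans (S-step (s≤s (*-monoˡ-< 2 r<h)) (interleave-even E O r) (interleave-odd E O r)) (sum-uw (suc h) r))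
            (if-yes (r ≤? h) (<⇒≤ r<h))
            (≤-trans (<⇒≤ r<h) (m≤m*n h 2))
            (*-monoˡ-< 2 r<h)
  ...   | inj₂ refl = record
    { x = h ; σ = h
    ; X≡ = interleave-even E O h
    ; S≡ = trans (S-last (interleave-even E O h) refl) (+-identityʳ h)
    ; unX≡ = if-yes (h ≤? h) ≤-refl
    ; unS≡ = if-yes (h ≤? h) ≤-refl
    ; x∈V = m≤m*n h 2
    ; σ∈T = inj₁ refl
    }

  T-bounds : ∀ {σ} → T σ → h ≤ σ × σ ≤ h * 3
  T-bounds (inj₁ refl) = ≤-refl , m≤m*n h 3
  T-bounds (inj₂ (i , i<2h , refl)) =
    ≤-trans (m≤m+n h i) (n≤1+n _)
    , ≤-trans (≤-reflexive (sym (+-suc h i))) (≤-trans (+-monoʳ-≤ h i<2h) (≤-reflexive (three h)))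
    where
    three : ∀ h → h + h * 2 ≡ h * 3
    three = solve-∀

  cycle-seed : CycleSeed (suc (h * 2))
  cycle-seed = seed K unX unS V T
    (λ x≤2h → ≤-trans (s≤s x≤2h) (m≤m+n _ _))
    (λ σ∈T → let (h≤σ , σ≤3h) = T-bounds σ∈T in
       ≤-trans σ≤3h (≤-trans (*-monoʳ-≤ h (s≤s (s≤s (s≤s z≤n)))) (n≤1+n _))
     , ≤-trans (≤-reflexive (K+1 h)) (+-monoˡ-≤ _ h≤σ))
    (λ x≤2h σ∈T x+σ≡K → <-irrefl x+σ≡K
       (s≤s (≤-trans (+-mono-≤ x≤2h (proj₂ (T-bounds σ∈T))) (≤-reflexive (five h)))))
    profile
    where
    K+1 : ∀ h → suc (suc (h * 5)) ≡ h + (suc (h * 2) + suc (h * 2))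
    K+1 = solve-∀
    five : ∀ h → h * 2 + h * 3 ≡ h * 5
    five = solve-∀

-- Singly even cycles, m = 2h with h = 2g + 1 odd (g ≥ 1).  With the low
-- labels u r = r and the high labels w r = h + r, the pair at positions
-- (2r, 2r+1) is (w r, u r) for r ≤ g and (u r, w r) for r > g, except that
-- position 0 gets w h = 2h instead of w 0 = h.  The edge {i, i+1} then has
-- sum h + i, except the edges at positions 0 (sum 2h), h (sum h) and 2h−1
-- (sum 4h−1).  Hence the vertex labels are 0,…,2h without h, and with
-- K = 5h − 1 the edge labels are h and 2h+1,…,4h−1.

module SinglyEvenCycle (a : ℕ) where

  g h : ℕ
  g = suc a
  h = suc (g * 2)

  u w : ℕ → ℕ
  u r = r
  w r = h + r

  E O X : ℕ → ℕ
  E zero    = w h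
  E (suc r) = if does (suc r ≤? g) then w (suc r) else u (suc r)
  O r       = if does (r ≤? g) then u r else w r
  X         = interleave E O

  open VertexLabels (suc (g * 2 * 2)) X using (S; S-step; S-last; Profile; seed)

  -- the largest edge sum 4h − 1, and K = 5h − 1
  top K : ℕ
  top = h + (h + (h + g * 2))
  K   = h + top

  -- A label below h is some u r, otherwise some w r; r determines the position.
  unX unS : ℕ → ℕ
  unX v = if does (v <? h)
            then (if does (v ≤? g) then suc (v * 2) else v * 2)
            else (if does (v ∸ h ≤? g) then (v ∸ h) * 2
                  else if does (v ∸ h <? h) then suc ((v ∸ h) * 2) else 0)
  unS σ = if does (σ ≤? h) then h
          else (if does (σ ∸ h ≟ h) then 0
                else if does (σ ∸ h <? h * 2) then σ ∸ h else suc (g * 2 * 2))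

  V T : ℕ → Set
  V x = x ≤ h * 2 × x ≢ h
  T σ = σ ≡ top ⊎ ∃[ i ] (suc i < h * 2 × σ ≡ h + i)

  g<h : g < h
  g<h = s≤s (m≤m*n g 2)

  E-w : ∀ {r} → suc r ≤ g → E (suc r) ≡ w (suc r)
  E-w le = if-yes (_ ≤? g) le

  E-u : ∀ {r} → ¬ suc r ≤ g → E (suc r) ≡ u (suc r)
  E-u ¬le = if-no (_ ≤? g) ¬le

  O-u : ∀ {r} → r ≤ g → O r ≡ u r
  O-u le = if-yes (_ ≤? g) le

  O-w : ∀ {r} → ¬ r ≤ g → O r ≡ w r
  O-w ¬le = if-no (_ ≤? g) ¬le

  unX-u≤ : ∀ {r} → r ≤ g → unX r ≡ suc (r * 2)
  unX-u≤ r≤g = trans (if-yes (_ <? h) (≤-<-trans r≤g g<h)) (if-yes (_ ≤? g) r≤g)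

  unX-u> : ∀ {r} → g < r → r < h → unX r ≡ r * 2
  unX-u> g<r r<h = trans (if-yes (_ <? h) r<h) (if-no (_ ≤? g) (<⇒≱ g<r))

  unX-w≤ : ∀ {r} → r ≤ g → unX (h + r) ≡ r * 2
  unX-w≤ {r} r≤g = trans (if-no (h + r <? h) (m+n≮m h r))
    (trans (if-yes (h + r ∸ h ≤? g) (subst (_≤ g) (sym (m+n∸m≡n h r)) r≤g)) (cong (_* 2) (m+n∸m≡n h r)))

  unX-w> : ∀ {r} → g < r → r < h → unX (h + r) ≡ suc (r * 2)
  unX-w> {r} g<r r<h = trans (if-no (h + r <? h) (m+n≮m h r))
    (trans (if-no (h + r ∸ h ≤? g) (λ le → <⇒≱ g<r (subst (_≤ g) (m+n∸m≡n h r) le)))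
    (trans (if-yes (h + r ∸ h <? h) (subst (_< h) (sym (m+n∸m≡n h r)) r<h)) (cong (λ v → suc (v * 2)) (m+n∸m≡n h r))))

  u∈V : ∀ {r} → r < h → V (u r)
  u∈V r<h = ≤-trans (<⇒≤ r<h) (m≤m*n h 2) , <⇒≢ r<h

  w∈V : ∀ {r} → 0 < r → r ≤ h → V (w r)
  w∈V 0<r r≤h = ≤-trans (+-monoʳ-≤ h r≤h) (≤-reflexive (+-double h)) , λ e → <⇒≢ (m<m+n h 0<r) (sym e)

  even-pos : ∀ {r} → r < h → suc (r * 2) < h * 2
  even-pos r<h = *-monoˡ-≤ 2 r<h

  odd-pos : ∀ {r} → suc r < h → suc (suc (r * 2)) < h * 2
  odd-pos sr<h = ≤-trans (n≤1+n _) (*-monoˡ-≤ 2 sr<h)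

  regular : ∀ {i x} → X i ≡ x → S i ≡ h + i → unX x ≡ i → V x →
            0 < i → i ≢ h → suc i < h * 2 → Profile unX unS V T i
  regular {i} X≡ S≡ unX≡ x∈V 0<i i≢h si<2h = record
    { X≡ = X≡ ; S≡ = S≡ ; unX≡ = unX≡ ; x∈V = x∈V
    ; unS≡ = trans (if-no (h + i ≤? h) (<⇒≱ (m<m+n h 0<i)))
             (trans (if-no (h + i ∸ h ≟ h) (λ e → i≢h (trans (sym i′) e)))
             (trans (if-yes (h + i ∸ h <? h * 2) (subst (_< h * 2) (sym i′) (<-trans (n<1+n i) si<2h))) i′))
    ; σ∈T = inj₂ (i , si<2h , refl)
    }
    where
    i′ : h + i ∸ h ≡ i
    i′ = m+n∸m≡n h i

  profile : ∀ {i} → i < h * 2 → Profile unX unS V T i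
  profile {i} i<m with parity i
  ... | even zero = record
    { x = h + h ; σ = h + h
    ; X≡ = refl
    ; S≡ = trans (S-step (s≤s (s≤s z≤n)) refl (O-u z≤n)) (+-identityʳ _)
    ; unX≡ = trans (if-no (h + h <? h) (m+n≮m h h))
             (trans (if-no (h + h ∸ h ≤? g) (λ le → <⇒≱ g<h (subst (_≤ g) (m+n∸m≡n h h) le)))
                    (if-no (h + h ∸ h <? h) (λ lt → <-irrefl refl (subst (_< h) (m+n∸m≡n h h) lt))))
    ; unS≡ = trans (if-no (h + h ≤? h) (<⇒≱ (m<m+n h (s≤s z≤n)))) (if-yes (h + h ∸ h ≟ h) (m+n∸m≡n h h))
    ; x∈V = w∈V (s≤s z≤n) ≤-refl
    ; σ∈T = inj₂ (h , subst₂ _<_ (+-comm h 1) (+-double h) (+-monoʳ-< h (s≤s (s≤s z≤n))) , refl)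
    }
  ... | even (suc r) with suc r ≤? g
  ...   | yes r≤g =
    regular X≡ (trans (S-step (even-pos r<h) X≡ (trans (interleave-odd E O (suc r)) (O-u r≤g))) (sum-wu h (suc r)))
            (unX-w≤ r≤g) (w∈V (s≤s z≤n) (<⇒≤ r<h))
            (s≤s z≤n) (λ e → <⇒≢ (≤-<-trans (*-monoˡ-≤ 2 r≤g) (n<1+n (g * 2))) e) (even-pos r<h)
    where
    r<h : suc r < h
    r<h = ≤-<-trans r≤g g<h
    X≡ : X (suc r * 2) ≡ w (suc r)
    X≡ = trans (interleave-even E O (suc r)) (E-w r≤g)
  ...   | no r≰g =
    regular X≡ (trans (S-step (even-pos r<h) X≡ (trans (interleave-odd E O (suc r)) (O-w r≰g))) (sum-uw h (suc r)))
            (unX-u> (≰⇒> r≰g) r<h) (u∈V r<h)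
            (s≤s z≤n) (λ e → <⇒≢ (*-monoˡ-≤ 2 (≰⇒> r≰g)) (sym e)) (even-pos r<h)
    where
    r<h : suc r < h
    r<h = *-cancelʳ-< 2 (suc r) h i<m
    X≡ : X (suc r * 2) ≡ u (suc r)
    X≡ = trans (interleave-even E O (suc r)) (E-u r≰g)
  profile i<m | odd r with <-cmp r g
  ... | tri< r<g _ _ =
    regular X≡ (trans (S-step (odd-pos sr<h) X≡ (trans (interleave-even E O (suc r)) (E-w r<g))) (sum-uw′ h r))
            (unX-u≤ (<⇒≤ r<g)) (u∈V (<-trans r<g g<h))
            (s≤s z≤n) (λ e → <⇒≢ r<g (*-cancelʳ-≡ r g 2 (suc-injective e))) (odd-pos sr<h)
    where
    sr<h : suc r < h
    sr<h = ≤-<-trans r<g g<h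
    X≡ : X (suc (r * 2)) ≡ u r
    X≡ = trans (interleave-odd E O r) (O-u (<⇒≤ r<g))
  ... | tri≈ _ refl _ = record
    { x = u g ; σ = h
    ; X≡ = X≡
    ; S≡ = trans (S-step (odd-pos (s≤s g<2g)) X≡ (trans (interleave-even E O (suc g)) (E-u (<-irrefl refl))))
                 (trans (+-suc g g) (cong suc (+-double g)))
    ; unX≡ = unX-u≤ ≤-refl
    ; unS≡ = if-yes (h ≤? h) ≤-refl
    ; x∈V = u∈V g<h
    ; σ∈T = inj₂ (0 , s≤s (s≤s z≤n) , sym (+-identityʳ h))
    }
    where
    g<2g : g < g * 2
    g<2g = s≤s (s≤s (m≤m*n a 2))
    X≡ : X (suc (g * 2)) ≡ u g
    X≡ = trans (interleave-odd E O g) (O-u ≤-refl)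
  ... | tri> _ _ g<r with suc r <? h
  ...   | yes sr<h =
    regular X≡ (trans (S-step (odd-pos sr<h) X≡ (trans (interleave-even E O (suc r)) (E-u (<⇒≱ (m<n⇒m<1+n g<r)))))
                      (sum-wu′ h r))
            (unX-w> g<r (<-trans (n<1+n r) sr<h)) (w∈V (≤-<-trans z≤n g<r) (<⇒≤ (<-trans (n<1+n r) sr<h)))
            (s≤s z≤n) (λ e → <⇒≢ g<r (sym (*-cancelʳ-≡ r g 2 (suc-injective e)))) (odd-pos sr<h)
    where
    X≡ : X (suc (r * 2)) ≡ w r
    X≡ = trans (interleave-odd E O r) (O-w (<⇒≱ g<r))
  ...   | no sr≮h with suc-injective (≤-antisym (*-cancelʳ-≤ (suc r) h 2 i<m) (≮⇒≥ sr≮h))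
  ...     | refl = record
    { x = w (g * 2) ; σ = top
    ; X≡ = X≡
    ; S≡ = trans (S-last X≡ refl) (rearrange h (g * 2))
    ; unX≡ = unX-w> g<r (n<1+n (g * 2))
    ; unS≡ = trans (if-no (top ≤? h) (<⇒≱ (m<m+n h (s≤s z≤n))))
             (trans (if-no (top ∸ h ≟ h) (λ e → <⇒≢ (m<m+n h (s≤s z≤n)) (sym (trans (sym top-h) e))))
                    (if-no (top ∸ h <? h * 2) (≤⇒≯ (subst (h * 2 ≤_) (sym top-h)
                       (≤-trans (≤-reflexive (sym (+-double h))) (+-monoʳ-≤ h (m≤m+n h _)))))))
    ; x∈V = w∈V (≤-<-trans z≤n g<r) (n≤1+n _)
    ; σ∈T = inj₁ refl
    }
    where
    X≡ : X (suc (g * 2 * 2)) ≡ w (g * 2)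
    X≡ = trans (interleave-odd E O (g * 2)) (O-w (<⇒≱ g<r))
    rearrange : ∀ x y → x + y + (x + x) ≡ x + (x + (x + y))
    rearrange = solve-∀
    top-h : top ∸ h ≡ h + (h + g * 2)
    top-h = m+n∸m≡n h _

  4h : suc top ≡ h * 2 + h * 2
  4h = four g
    where
    four : ∀ g → suc (suc (g * 2) + (suc (g * 2) + (suc (g * 2) + g * 2))) ≡ suc (g * 2) * 2 + suc (g * 2) * 2
    four = solve-∀

  cycle-seed : CycleSeed (h * 2)
  cycle-seed = seed K unX unS V T
    (λ (x≤2h , _) → ≤-<-trans x≤2h (m<m+n (h * 2) (s≤s z≤n)))
    T-range V+T≢K profile
    where
    T-range : ∀ {σ} → T σ → σ ≤ K × K < σ + (h * 2 + h * 2)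
    T-range (inj₁ refl) =
      m≤n+m top h , subst (_< top + (h * 2 + h * 2)) (+-comm top h) (+-monoʳ-< top h<4h)
      where
      h<4h : h < h * 2 + h * 2
      h<4h = <-≤-trans (m<m+n h (s≤s z≤n)) (≤-trans (≤-reflexive (+-double h)) (m≤m+n _ _))
    T-range (inj₂ (i , si<2h , refl)) =
      +-monoʳ-≤ h (≤-trans (<⇒≤ (<-trans (n<1+n i) si<2h)) 2h≤top)
      , subst (K <_) (sym (+-assoc h i _)) (+-monoʳ-< h (≤-trans (≤-reflexive 4h) (m≤n+m _ i)))
      where
      2h≤top : h * 2 ≤ top
      2h≤top = ≤-trans (≤-reflexive (sym (+-double h))) (+-monoʳ-≤ h (m≤m+n h _))
    V+T≢K : ∀ {x σ} → V x → T σ → x + σ ≢ K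
    V+T≢K (_ , x≢h) (inj₁ refl) eq = x≢h (+-cancelʳ-≡ top _ _ eq)
    V+T≢K {x} (x≤2h , _) (inj₂ (i , si<2h , refl)) eq = <⇒≢ x+i<top (+-cancelˡ-≡ h _ _ (trans (sym (swap x h i)) eq))
      where
      swap : ∀ x h i → x + (h + i) ≡ h + (x + i)
      swap = solve-∀
      x+i<top : x + i < top
      x+i<top = s≤s⁻¹ (subst₂ _≤_ (trans (+-suc x (suc i)) (cong suc (+-suc x i))) (sym 4h) (+-mono-≤ x≤2h si<2h))

-- Doubly even cycles, m = 2h with h = 2g even (g ≥ 1).  With the low labels
-- u r = r + 1 and the high labels w r = h + r, the pair at positions
-- (2r, 2r+1) is (w r, u r) for r < g and (u r, w r) for r ≥ g, except that
-- position 0 gets w (2h−1) = 3h−1 and the last position gets 0.  The edge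
-- {i, i+1} then has sum h + 1 + i, except at positions h−1 (sum h+1),
-- 2h−2 (sum h), 2h−1 (sum 3h−1) and 0 (sum 3h).  Hence the vertex labels
-- are 0,…,2h−2 and 3h−1, the edge sums are h,…,3h without 2h, and with
-- K = 5h − 1 the edge labels are 2h−1,…,4h−1 without 3h−1.

module DoublyEvenCycle (a : ℕ) where

  g h last : ℕ
  g    = suc a
  h    = g * 2
  last = suc (suc (suc (a * 2 * 2)))

  -- the positions 2h − 2 and h − 1
  last₋₁ h₋₁ : ℕ
  last₋₁ = suc (suc (a * 2 * 2))
  h₋₁    = suc (a * 2)

  u w : ℕ → ℕ
  u r = suc r
  w r = h + r

  E O X : ℕ → ℕ
  E zero    = w last
  E (suc r) = if does (suc r <? g) then w (suc r) else u (suc r)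
  O r       = if does (r <? g) then u r else if does (suc r <? h) then w r else 0
  X         = interleave E O

  open VertexLabels last X using (S; S-step; S-last; Profile; seed)

  K : ℕ
  K = w last + h * 2

  -- Labels up to h are low labels u r, the others high labels w r (or 0);
  -- an edge sum h + 1 + j is decoded from j.
  unX unS : ℕ → ℕ
  unX zero    = last
  unX (suc v) = if does (v <? h)
                  then (if does (v <? g) then suc (v * 2) else v * 2)
                  else (if does (suc v ∸ h <? g) then (suc v ∸ h) * 2
                        else if does (suc v ∸ h <? h) then suc ((suc v ∸ h) * 2) else 0)
  unS σ = if does (σ ≤? h) then last₋₁
          else if does (σ ≤? suc h) then h₋₁
          else if does (σ ∸ suc h <? last₋₁) then σ ∸ suc h
          else if does (σ ∸ suc h ≟ last₋₁) then last else 0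

  V T : ℕ → Set
  V x = suc x < h * 2 ⊎ x ≡ w last
  T σ = ∃[ j ] (j ≤ h * 2 × j ≢ h × σ ≡ h + j)

  g<h : g < h
  g<h = s≤s (s≤s (m≤m*n a 2))

  h<2h : h < h * 2
  h<2h = <-≤-trans (m<m+n h (s≤s z≤n)) (≤-reflexive (+-double h))

  E-w : ∀ {r} → suc r < g → E (suc r) ≡ w (suc r)
  E-w lt = if-yes (_ <? g) lt

  E-u : ∀ {r} → ¬ suc r < g → E (suc r) ≡ u (suc r)
  E-u ¬lt = if-no (_ <? g) ¬lt

  O-u : ∀ {r} → r < g → O r ≡ u r
  O-u lt = if-yes (_ <? g) lt

  O-w : ∀ {r} → ¬ r < g → suc r < h → O r ≡ w r
  O-w ¬lt sr<h = trans (if-no (_ <? g) ¬lt) (if-yes (_ <? h) sr<h)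

  O-0 : ∀ {r} → ¬ r < g → ¬ suc r < h → O r ≡ 0
  O-0 ¬lt ¬sr<h = trans (if-no (_ <? g) ¬lt) (if-no (_ <? h) ¬sr<h)

  unX-u< : ∀ {r} → r < g → unX (u r) ≡ suc (r * 2)
  unX-u< r<g = trans (if-yes (_ <? h) (<-trans r<g g<h)) (if-yes (_ <? g) r<g)

  unX-u≥ : ∀ {r} → g ≤ r → r < h → unX (u r) ≡ r * 2
  unX-u≥ g≤r r<h = trans (if-yes (_ <? h) r<h) (if-no (_ <? g) (≤⇒≯ g≤r))

  -- w (suc r) = suc (h₋₁ + suc r) is not a low label
  w-high : ∀ r → ¬ (h₋₁ + suc r < h)
  w-high r lt = <⇒≱ lt (subst (h ≤_) (sym (+-suc h₋₁ r)) (s≤s (m≤m+n h₋₁ r)))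

  unX-w< : ∀ {r} → suc r < g → unX (w (suc r)) ≡ suc r * 2
  unX-w< {r} sr<g = trans (if-no (_ <? h) (w-high r))
    (trans (if-yes (h + suc r ∸ h <? g) (subst (_< g) (sym (m+n∸m≡n h (suc r))) sr<g)) (cong (_* 2) (m+n∸m≡n h (suc r))))

  unX-w≥ : ∀ {r} → g ≤ r → r < h → unX (w r) ≡ suc (r * 2)
  unX-w≥ {suc r} g≤r r<h = trans (if-no (_ <? h) (w-high r))
    (trans (if-no (h + suc r ∸ h <? g) (≤⇒≯ (subst (g ≤_) (sym (m+n∸m≡n h (suc r))) g≤r)))
    (trans (if-yes (h + suc r ∸ h <? h) (subst (_< h) (sym (m+n∸m≡n h (suc r))) r<h))
           (cong (λ v → suc (v * 2)) (m+n∸m≡n h (suc r)))))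

  unS-high : ∀ {j} → 0 < j →
             unS (h + suc j) ≡ (if does (j <? last₋₁) then j else if does (j ≟ last₋₁) then last else 0)
  unS-high {j} 0<j =
    trans (if-no (h + suc j ≤? h) (<⇒≱ (m<m+n h (s≤s z≤n))))
   (trans (if-no (h + suc j ≤? suc h) (<⇒≱ (subst (suc h <_) (sym (+-suc h j)) (s≤s (m<m+n h 0<j)))))
          (cong (λ v → if does (v <? last₋₁) then v else if does (v ≟ last₋₁) then last else 0)
                (trans (cong (_∸ suc h) (+-suc h j)) (m+n∸m≡n h j))))

  w∈V : ∀ {r} → suc r < h → V (w r)
  w∈V {r} sr<h = inj₁ (subst₂ _≤_ (trans (+-suc h (suc r)) (cong suc (+-suc h r))) (+-double h) (+-monoʳ-≤ h sr<h))

  even-pos : ∀ {r} → r < h → suc (r * 2) < h * 2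
  even-pos r<h = *-monoˡ-≤ 2 r<h

  odd-pos : ∀ {r} → suc r < h → suc (suc (r * 2)) < h * 2
  odd-pos sr<h = ≤-trans (n≤1+n _) (*-monoˡ-≤ 2 sr<h)

  inner-pos : ∀ {i} → suc (suc i) < h * 2 → i < last₋₁
  inner-pos lt = s≤s⁻¹ (s≤s⁻¹ lt)

  regular : ∀ {i x} → X i ≡ x → S i ≡ h + suc i → unX x ≡ i → V x →
            0 < i → suc (suc i) < h * 2 → i ≢ h₋₁ → Profile unX unS V T i
  regular {i} X≡ S≡ unX≡ x∈V 0<i ssi<2h i≢h₋₁ = record
    { X≡ = X≡ ; S≡ = S≡ ; unX≡ = unX≡ ; x∈V = x∈V
    ; unS≡ = trans (unS-high 0<i) (if-yes (i <? last₋₁) (inner-pos ssi<2h))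
    ; σ∈T = suc i , ≤-trans (inner-pos ssi<2h) (≤-trans (n≤1+n _) (n≤1+n _))
          , (λ e → i≢h₋₁ (suc-injective e)) , refl
    }

  profile : ∀ {i} → i < h * 2 → Profile unX unS V T i
  profile {i} i<m with parity i
  ... | even zero = record
    { x = w last ; σ = h + suc last
    ; X≡ = refl
    ; S≡ = trans (S-step (s≤s (s≤s z≤n)) refl (O-u (s≤s z≤n))) (+-one h last)
    ; unX≡ = trans (if-no (_ <? h) (w-high _))
             (trans (if-no (h + last ∸ h <? g)
                           (≤⇒≯ (subst (g ≤_) (sym (m+n∸m≡n h last)) (≤-trans (<⇒≤ g<h) h≤last))))
                    (if-no (h + last ∸ h <? h) (≤⇒≯ (subst (h ≤_) (sym (m+n∸m≡n h last)) h≤last))))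
    ; unS≡ = trans (unS-high (s≤s z≤n))
                   (trans (if-no (last <? last₋₁) (≤⇒≯ (n≤1+n _))) (if-no (last ≟ last₋₁) 1+n≢n))
    ; x∈V = inj₂ refl
    ; σ∈T = suc last , ≤-refl , (λ e → <⇒≢ (s≤s h≤last) (sym e)) , refl
    }
    where
    h≤last : h ≤ last
    h≤last = s≤s (s≤s (≤-trans (m≤m*n (a * 2) 2) (n≤1+n _)))
    +-one : ∀ x y → x + y + 1 ≡ x + suc y
    +-one = solve-∀
  ... | even (suc r) with suc r <? g
  ...   | yes r<g =
    regular X≡ (trans (S-step (even-pos r<h) X≡ (trans (interleave-odd E O (suc r)) (O-u r<g))) (sum-wu′ h (suc r)))
            (unX-w< r<g) (w∈V (≤-<-trans r<g g<h))
            (s≤s z≤n) (*-monoˡ-< 2 (≤-<-trans r<g g<h)) (even≢odd′ (suc r) a)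
    where
    r<h : suc r < h
    r<h = <-trans r<g g<h
    X≡ : X (suc r * 2) ≡ w (suc r)
    X≡ = trans (interleave-even E O (suc r)) (E-w r<g)
  ...   | no r≮g with suc (suc r) <? h
  ...     | yes sr<h =
    regular X≡ (trans (S-step (even-pos r<h) X≡ (trans (interleave-odd E O (suc r)) (O-w r≮g sr<h))) (sum-uw⁺ h (suc r)))
            (unX-u≥ (≮⇒≥ r≮g) r<h) (inj₁ (≤-trans (s≤s sr<h) h<2h))
            (s≤s z≤n) (odd-pos sr<h) (even≢odd′ (suc r) a)
    where
    r<h : suc r < h
    r<h = <-trans (n<1+n _) sr<h
    X≡ : X (suc r * 2) ≡ u (suc r)
    X≡ = trans (interleave-even E O (suc r)) (E-u r≮g)
  ...     | no sr≮h with suc-injective (suc-injective (≤-antisym (*-cancelʳ-< 2 (suc r) h i<m) (≮⇒≥ sr≮h)))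
  ...       | refl = record
    { x = u h₋₁ ; σ = h
    ; X≡ = X≡
    ; S≡ = trans (S-step (even-pos (n<1+n _)) X≡ (trans (interleave-odd E O h₋₁) (O-0 r≮g sr≮h))) (+-identityʳ h)
    ; unX≡ = unX-u≥ (≮⇒≥ r≮g) (n<1+n _)
    ; unS≡ = if-yes (h ≤? h) ≤-refl
    ; x∈V = inj₁ h+2≤2h
    ; σ∈T = 0 , z≤n , (λ ()) , sym (+-identityʳ h)
    }
    where
    X≡ : X (h₋₁ * 2) ≡ u h₋₁
    X≡ = trans (interleave-even E O h₋₁) (E-u r≮g)
    h+2≤2h : suc (suc h) ≤ h * 2
    h+2≤2h = subst₂ _≤_ (+-comm h 2) (+-double h) (+-monoʳ-≤ h (s≤s (s≤s z≤n)))
  profile i<m | odd r with suc r <? g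
  ... | yes sr<g =
    regular X≡ (trans (S-step (odd-pos sr<h) X≡ (trans (interleave-even E O (suc r)) (E-w sr<g))) (sum-uw h (suc r)))
            (unX-u< (<-trans (n<1+n r) sr<g)) (inj₁ (≤-trans (s≤s sr<h) h<2h))
            (s≤s z≤n) (*-monoˡ-≤ 2 sr<h) (λ e → <⇒≢ (s≤s⁻¹ sr<g) (*-cancelʳ-≡ r a 2 (suc-injective e)))
    where
    sr<h : suc r < h
    sr<h = <-trans sr<g g<h
    X≡ : X (suc (r * 2)) ≡ u r
    X≡ = trans (interleave-odd E O r) (O-u (<-trans (n<1+n r) sr<g))
  ... | no sr≮g with suc r ≟ g
  ...   | yes refl = record
    { x = u a ; σ = suc h
    ; X≡ = X≡
    ; S≡ = trans (S-step (odd-pos g<h) X≡ (trans (interleave-even E O (suc a)) (E-u sr≮g))) (middle a)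
    ; unX≡ = unX-u< (n<1+n a)
    ; unS≡ = trans (if-no (suc h ≤? h) 1+n≰n) (if-yes (suc h ≤? suc h) ≤-refl)
    ; x∈V = inj₁ (≤-trans (s≤s g<h) h<2h)
    ; σ∈T = 1 , ≤-trans (s≤s z≤n) (<⇒≤ h<2h) , (λ e → 1+n≢0 (suc-injective (sym e))) , sym (+-comm h 1)
    }
    where
    X≡ : X (suc (a * 2)) ≡ u a
    X≡ = trans (interleave-odd E O a) (O-u (n<1+n a))
    middle : ∀ a → suc a + suc (suc a) ≡ suc (suc (suc (a * 2)))
    middle = solve-∀
  ...   | no sr≢g with suc r <? h
  ...     | yes sr<h =
    regular X≡ (trans (S-step (odd-pos sr<h) X≡ (trans (interleave-even E O (suc r)) (E-u sr≮g))) (sum-wu⁺ h r))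
            (unX-w≥ g≤r (<-trans (n<1+n r) sr<h)) (w∈V sr<h)
            (s≤s z≤n) (*-monoˡ-≤ 2 sr<h) (λ e → <⇒≢ g≤r (sym (*-cancelʳ-≡ r a 2 (suc-injective e))))
    where
    g≤r : g ≤ r
    g≤r = s≤s⁻¹ (≤∧≢⇒< (≮⇒≥ sr≮g) (≢-sym sr≢g))
    X≡ : X (suc (r * 2)) ≡ w r
    X≡ = trans (interleave-odd E O r) (O-w (≤⇒≯ g≤r) sr<h)
  ...     | no sr≮h with suc-injective (≤-antisym (*-cancelʳ-< 2 r h (≤-trans (n≤1+n _) i<m)) (≮⇒≥ sr≮h))
  ...       | refl = record
    { x = 0 ; σ = h + last
    ; X≡ = X≡
    ; S≡ = S-last X≡ refl
    ; unX≡ = refl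
    ; unS≡ = trans (unS-high (s≤s z≤n))
                   (trans (if-no (last₋₁ <? last₋₁) (<-irrefl refl)) (if-yes (last₋₁ ≟ last₋₁) refl))
    ; x∈V = inj₁ (s≤s (s≤s z≤n))
    ; σ∈T = last , n≤1+n last , (λ e → <⇒≢ (s≤s (s≤s (s≤s (m≤m*n (a * 2) 2)))) (sym e)) , refl
    }
    where
    X≡ : X last ≡ 0
    X≡ = trans (interleave-odd E O h₋₁) (O-0 (≤⇒≯ (s≤s (m≤m*n a 2))) sr≮h)

  cycle-seed : CycleSeed (h * 2)
  cycle-seed = seed K unX unS V T V<4h T-range V+T≢K profile
    where
    4h : ℕ
    4h = h * 2 + h * 2
    V<4h : ∀ {x} → V x → x < 4h
    V<4h (inj₁ sx<2h) = <-trans (<-trans (n<1+n _) sx<2h) (m<m+n (h * 2) (s≤s z≤n))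
    V<4h (inj₂ refl)  = +-mono-< h<2h (n<1+n last)
    T-range : ∀ {σ} → T σ → σ ≤ K × K < σ + 4h
    T-range (j , j≤2h , _ , refl) =
        subst (h + j ≤_) (sym (+-assoc h last (h * 2))) (+-monoʳ-≤ h (≤-trans j≤2h (m≤n+m _ last)))
      , subst₂ _<_ (sym (+-assoc h last (h * 2))) (sym (+-assoc h j 4h))
          (+-monoʳ-< h (<-≤-trans (+-monoˡ-< (h * 2) (n<1+n last)) (m≤n+m 4h j)))
    V+T≢K : ∀ {x σ} → V x → T σ → x + σ ≢ K
    V+T≢K {x} (inj₁ sx<2h) (j , j≤2h , _ , refl) eq =
      1+n≰n (subst (λ t → suc t ≤ K) eq
               (s≤s⁻¹ (subst (suc (suc (x + (h + j))) ≤_) 5h (+-mono-≤ sx<2h (+-monoʳ-≤ h j≤2h)))))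
      where
      5h : h * 2 + (h + h * 2) ≡ suc K
      5h = five a
        where
        five : ∀ a → suc a * 2 * 2 + (suc a * 2 + suc a * 2 * 2)
                     ≡ suc (suc a * 2 + suc (suc (suc (a * 2 * 2))) + suc a * 2 * 2)
        five = solve-∀
    V+T≢K (inj₂ refl) (j , _ , j≢h , refl) eq =
      j≢h (+-cancelˡ-≡ h _ _ (trans (+-cancelˡ-≡ (w last) _ _ eq) (sym (+-double h))))

cycle-seed : ∀ k → 2 ≤ k → CycleSeed (suc k)
cycle-seed k 2≤k with parity k
... | even h = OddCycle.cycle-seed h
... | odd r with parity r
...   | even zero    = ⊥-elim (<-irrefl refl 2≤k)
...   | even (suc a) = SinglyEvenCycle.cycle-seed a
...   | odd a        = DoublyEvenCycle.cycle-seed a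

corollary2p7 : (m : ℕ) → 3 ≤ m →
    (B : ℕ) → ∃[ N ] ((n : ℕ) → N ≤ n → CardTauAtLeast (corona m n) B)
corollary2p7 (suc k) (s≤s 2≤k) B = B , many-valences (cycle-seed k 2≤k) B
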